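{- Let $A$ be a finite non-empty set of agents, $M$ a simplicial secrecy model, $X$ a facet of $M$, $a\in A$ and $\varphi\in\mathcal{L}_{KS}$. If $M,X\Vdash S_a\varphi$, then: (1) $M,X\Vdash K_a\varphi$; (2) $M,X\Vdash\varphi$; (3) for every $b\in A\setminus\{a\}$, $M,X\Vdash\neg K_b\varphi$; (4) for every $b\in A\setminus\{a\}$, $M,X\Vdash\neg K_b\neg\varphi$.
   Context: A simplicial complex is a pair $(V,\mathcal{F})$ with $V$ a non-empty set and $\mathcal{F}$ a non-empty family of finite non-empty subsets of $V$ (faces), closed under non-empty subsets. A facet is an inclusion-maximal face; $\mathrm{Fac}$ denotes the set of facets. An $A$-chromatic simplicial complex is $(V,\mathcal{F},\chi)$ with $\chi:V\to A$ injective on every face. An $A$-chromatic simplicial epistemic model is $(V,\mathcal{F},\chi,\nu)$ where $(V,\mathcal{F},\chi)$ is $A$-chromatic, every facet $X$ satisfies $\chi[X]=A$, every vertex lies in some facet, and $\nu:\mathrm{Fac}\to\mathcal{P}(\mathsf{Prop})$ for a countable set $\mathsf{Prop}$ of variables. For a facet $X$ and $a\in A$, $v_a(X)$ is the unique vertex of colour $a$ in $X$; $\mathrm{St}(v)=\{X\in\mathrm{Fac}: v\in X\}$; $X\sim_a Y$ iff $v_a(X)=v_a(Y)$. A simplicial secrecy model is $M=(V,\mathcal{F},\chi,\nu,\{N^S_a\}_{a\in A})$ where $(V,\mathcal{F},\chi,\nu)$ is such a model and, with $V_a=\{v:\chi(v)=a\}$, each $N_a^S:V_a\to\mathcal{P}(\mathcal{P}(\mathrm{Fac}(M)))$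 satisfies (SN): for every $a$, $v\in V_a$, $U\in N_a^S(v)$, every $X\in\mathrm{St}(v)$ and every $b\in A\setminus\{a\}$ there is a facet $Y$ with $X\sim_b Y$ and $Y\notin U$. The language $\mathcal{L}_{KS}$ is $\varphi::=p\mid\neg\varphi\mid(\varphi\wedge\varphi)\mid K_a\varphi\mid S_a\varphi$. Truth at facets: $M,X\Vdash p$ iff $p\in\nu(X)$; Boolean clauses as usual; $M,X\Vdash K_a\varphi$ iff $M,Y\Vdash\varphi$ for all $Y$ with $X\sim_a Y$; $M,X\Vdash S_a\varphi$ iff $M,X\Vdash K_a\varphi$ and $[\![\varphi]\!]\in N_a^S(v_a(X))$, where $[\![\varphi]\!]=\{Y\in\mathrm{Fac}(M):M,Y\Vdash\varphi\}$. -}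

module Defs where

open import Level using (Level; 0ℓ) renaming (suc to lsuc)
open import Data.Nat using (ℕ; suc)
open import Data.Fin using (Fin)
open import Data.List using (List)
open import Data.List.Membership.Propositional using (_∈_)
open import Data.Product using (Σ; ∃; _×_; _,_; proj₁; proj₂)
open import Relation.Unary using (Pred; _⊆_)
open import Relation.Binary.PropositionalEquality using (_≡_)
open import Relation.Nullary using (¬_)
open import Function.Bundles using (_↔_)

FiniteNonEmpty : Set → Set
FiniteNonEmpty A = Σ ℕ λ n → A ↔ Fin (suc n)

Finite : {V : Set} → Pred V 0ℓ → Set
Finite {V} X = Σ (List V) λ xs → ∀ v → X v → v ∈ xs

NonEmpty : {V : Set} → Pred V 0ℓ → Set
NonEmpty X = ∃ λ v → X v

PropVar : Set
PropVar = ℕ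

record SimplicialComplex (V : Set) : Set₁ where
  field
    Face           : Pred (Pred V 0ℓ) 0ℓ
    face-finite    : ∀ X → Face X → Finite X
    face-nonempty  : ∀ X → Face X → NonEmpty X
    some-face      : ∃ λ X → Face X
    face-closed    : ∀ X Y → Face X → Y ⊆ X → NonEmpty Y → Face Y

  IsFacet : Pred V 0ℓ → Set₁
  IsFacet X = Face X × (∀ Y → Face Y → X ⊆ Y → Y ⊆ X)

  Fac : Set₁
  Fac = Σ (Pred V 0ℓ) IsFacet

record EpistemicModel (A : Set) : Set₂ where
  field
    V        : Set
    complex  : SimplicialComplex V
  open SimplicialComplex complex public
  field
    χ          : V → A
    χ-inj      : ∀ X → Face X → ∀ u w → X u → X w → χ u ≡ χ w → u ≡ w
    colourful  : (X : Fac) → (a : A) → Σ V λ v → proj₁ X v × χ v ≡ a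
    covered    : (v : V) → Σ Fac λ X → proj₁ X v
    ν          : Fac → Pred PropVar 0ℓ

  V[_] : A → Set
  V[ a ] = Σ V λ v → χ v ≡ a

  -- v_a(X): the (unique, by χ-inj) vertex of colour a in the facet X
  vtx : Fac → (a : A) → V[ a ]
  vtx X a = proj₁ (colourful X a) , proj₂ (proj₂ (colourful X a))

  St : V → Pred Fac 0ℓ
  St v X = proj₁ X v

  _∼[_]_ : Fac → A → Fac → Set
  X ∼[ a ] Y = proj₁ (vtx X a) ≡ proj₁ (vtx Y a)

record SecrecyModel (A : Set) : Set₃ where
  field
    epi : EpistemicModel A
  open EpistemicModel epi public
  field
    N  : (a : A) → V[ a ] → Pred (Pred Fac (lsuc 0ℓ)) (lsuc 0ℓ)
    SN : ∀ a (v : V[ a ]) (U : Pred Fac (lsuc 0ℓ)) → N a v U →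
         ∀ (X : Fac) → St (proj₁ v) X →
         ∀ b → ¬ (b ≡ a) → Σ Fac λ Y → X ∼[ b ] Y × ¬ U Y

data Form (A : Set) : Set where
  var  : PropVar → Form A
  ¬'_  : Form A → Form A
  _∧'_ : Form A → Form A → Form A
  K    : A → Form A → Form A
  S    : A → Form A → Form A

module _ {A : Set} (M : SecrecyModel A) where
  open SecrecyModel M

  infix 4 _⊩_
  _⊩_ : Fac → Form A → Set₁
  X ⊩ var p     = Level.Lift _ (ν X p)
  X ⊩ ¬' φ      = ¬ (X ⊩ φ)
  X ⊩ (φ ∧' ψ)  = (X ⊩ φ) × (X ⊩ ψ)
  X ⊩ K a φ     = ∀ Y → X ∼[ a ] Y → Y ⊩ φ
  X ⊩ S a φ     = (∀ Y → X ∼[ a ] Y → Y ⊩ φ) × N a (vtx X a) (λ Y → Y ⊩ φ)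

  ⟦_⟧ : Form A → Pred Fac (lsuc 0ℓ)
  ⟦ φ ⟧ Y = Y ⊩ φ

  Sat : Fac → Form A → Set₁
  Sat = _⊩_

module Submission where

open import Defs
open import Data.Product using (_×_; _,_; proj₁; proj₂)
open import Relation.Binary.PropositionalEquality using (_≡_; refl)
open import Relation.Nullary using (¬_)

-- Secrecy is knowledge plus neighbourhood membership of the truth set; (SN) then
-- yields, for every other agent b, a b-indistinguishable facet outside that set.

module _ {A : Set} (M : SecrecyModel A) where
  open SecrecyModel M

  ∼-refl : ∀ {X} a → X ∼[ a ] X
  ∼-refl a = refl

  facet∈St-vtx : ∀ X a → St (proj₁ (vtx X a)) X
  facet∈St-vtx X a = proj₁ (proj₂ (colourful X a))

  secret⇒known : ∀ {X} a φ → Sat M X (S a φ) → Sat M X (K a φ)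
  secret⇒known a φ (known , _) = known

  known⇒true : ∀ {X} a φ → Sat M X (K a φ) → Sat M X φ
  known⇒true {X} a φ known = known X (∼-refl a)

  secret⇒unknown-to-others : ∀ {X} a φ → Sat M X (S a φ) →
    ∀ b → ¬ (b ≡ a) → Sat M X (¬' K b φ)
  secret⇒unknown-to-others {X} a φ (_ , inN) b b≢a knownByB
    with SN a (vtx X a) (⟦_⟧ M φ) inN X (facet∈St-vtx X a) b b≢a
  ... | Y , X∼Y , φ-fails = φ-fails (knownByB Y X∼Y)

  true⇒not-known-false : ∀ {X} b φ → Sat M X φ → Sat M X (¬' K b (¬' φ))
  true⇒not-known-false {X} b φ holds knownFalse = knownFalse X (∼-refl b) holds

proposition3p14 : (A : Set) → FiniteNonEmpty A → (M : SecrecyModel A) →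
    (X : SecrecyModel.Fac M) → (a : A) → (φ : Form A) →
    Sat M X (S a φ) →
    Sat M X (K a φ)
    × Sat M X φ
    × (∀ b → ¬ (b ≡ a) → Sat M X (¬' K b φ))
    × (∀ b → ¬ (b ≡ a) → Sat M X (¬' K b (¬' φ)))
proposition3p14 A _ M X a φ secret =
  known , holds ,
  secret⇒unknown-to-others M a φ secret ,
  λ b _ → true⇒not-known-false M b φ holds
  where
  known : Sat M X (K a φ)
  known = secret⇒known M a φ secret
  holds : Sat M X φ
  holds = known⇒true M a φ known
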